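{- Let $p$ be a prime, $n\ge1$ and $\tau\ge1$. Then $W^*_{\tau,n}(p)\cap\mathbb{Z}_p^n=\emptyset$.
   Context: $\mathbb{Z}_p$ denotes the $p$-adic integers. For $\bm{x}\in\mathbb{Q}_p^n$, $|\bm{x}|_p$ is the maximum of the $p$-adic absolute values of its components; for $\bm{r}\in\mathbb{Z}^n$, $|\bm{r}|$ is the maximum of the real absolute values of its components. $W^*_{\tau,n}(p)$ is the set of $\bm{x}\in\mathbb{Q}_p^n$ such that $|q\bm{x}-\bm{r}|_p<\max(|\bm{r}|,q)^{ -\tau}$ holds for infinitely many $(\bm{r},q)\in\mathbb{Z}^n\times\mathbb{N}$ with $p\mid q$ and for only finitely many $(\bm{r},q)\in\mathbb{Z}^n\times\mathbb{N}$ with $p\nmid q$. -}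

module Defs where

open import Data.Nat as ℕ using (ℕ; zero; suc; _^_; _<_; _≤_; _⊔_)
open import Data.Nat.Divisibility as ℕD using ()
open import Data.Integer as ℤ using (ℤ; +_; ∣_∣; _-_; _*_)
open import Data.Integer.Divisibility as ℤD using ()
open import Data.Rational as ℚ using (ℚ; 1ℚ)
open import Data.Fin using (Fin)
open import Data.Vec using (Vec; []; _∷_; lookup)
open import Data.List using (List)
open import Data.List.Membership.Propositional using (_∈_)
open import Data.Product using (_×_; _,_; ∃; Σ)
open import Relation.Nullary using (¬_)

-- A p-adic integer: a coherent sequence of residues, res k represents x mod p^k.
record Zp (p : ℕ) : Set where
  field
    res      : ℕ → ℤ
    coherent : ∀ k → (+ (p ^ k)) ℤD.∣ (res (suc k) - res k)
open Zp public

-- A real number τ ≥ 1, given by its strict upper Dedekind cut {s ∈ ℚ | τ < s}.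
record RealGe1 : Set₁ where
  field
    Upper     : ℚ → Set
    inhabited : ∃ Upper
    upward    : ∀ {s t} → Upper s → s ℚ.≤ t → Upper t
    rounded   : ∀ {s} → Upper s → ∃ λ t → Upper t × t ℚ.< s
    geOne     : ∀ {s} → Upper s → 1ℚ ℚ.≤ s
open RealGe1 public

-- H ^ τ < N   (for H ≥ 1): some rational s = a/b > τ has H^a < N^b.
PowLt : RealGe1 → ℕ → ℕ → Set
PowLt τ H N = ∃ λ s → Upper τ s × (H ^ ∣ ℚ.numerator s ∣ < N ^ ℚ.denominatorℕ s)

maxAbs : ∀ {n} → Vec ℤ n → ℕ
maxAbs []       = 0
maxAbs (z ∷ zs) = ∣ z ∣ ⊔ maxAbs zs

height : ∀ {n} → Vec ℤ n → ℕ → ℕ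
height r q = maxAbs r ⊔ q

-- |q x - r|_p < max(|r|,q)^(-τ), i.e. ∃ k with p^k ∣ q x - r (componentwise)
-- and max(|r|,q)^τ < p^k.
Approx : (p : ℕ) {n : ℕ} → RealGe1 → Vec (Zp p) n → Vec ℤ n → ℕ → Set
Approx p {n} τ x r q = ∃ λ k →
  (∀ (i : Fin n) → (+ (p ^ k)) ℤD.∣ ((+ q) * res (lookup x i) k - lookup r i))
  × PowLt τ (height r q) (p ^ k)

FinitelyMany : ∀ {n} → (Vec ℤ n × ℕ → Set) → Set
FinitelyMany {n} P = ∃ λ (L : List (Vec ℤ n × ℕ)) → ∀ rq → P rq → rq ∈ L

InfinitelyMany : ∀ {n} → (Vec ℤ n × ℕ → Set) → Set
InfinitelyMany P = ¬ FinitelyMany P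

InWStar : (p n : ℕ) → RealGe1 → Vec (Zp p) n → Set
InWStar p n τ x =
  InfinitelyMany (λ { (r , q) → 1 ≤ q × (p ℕD.∣ q) × Approx p τ x r q })
  × FinitelyMany (λ { (r , q) → 1 ≤ q × ¬ (p ℕD.∣ q) × Approx p τ x r q })

module Submission where

-- Let p be prime, x ∈ ℤ_p^n, and suppose the approximations (r, q) of x with p ∤ q
-- all lie in a finite list L. We show that then all approximations lie in a finite
-- list as well, so x ∉ W*_{τ,n}(p).
--
-- * An approximation (r, q) at level k (q·x ≡ r mod p^k and max(|r|,q)^τ < p^k)
--   factors as p^j·(r₀, q₀) with p ∤ q₀, and (r₀, q₀) is an approximation at level
--   k − j (`primitivePart`); hence (r₀, q₀) ∈ L.
-- * If q₀·x = r₀ held exactly, the multiples m·(r₀, q₀) with p ∤ m would be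
--   approximations of unbounded height (`exact⇒tall`), impossible for a finite L.
-- * Classically (under a double negation, as the goal is ⊥) there is one level V
--   below which every non-exact member of L fails to solve q₀·x ≡ r₀ (`settledBound`).
-- * Then k − j < V, and a scaling exponent j ≥ V·m² forces the rational s = a/b > τ to
--   satisfy m²(a − b) < b, where m = p^(M+1) − 1 and M bounds the heights in L. But then
--   (m·x mod p^(M+1), m) is an approximation of height m > M (`nearOne⇒tall`).
-- * So every approximation is p^j·e with e ∈ L and j < V·m² (`approximations∈scalings`),
--   contradicting the infinitude of the approximations with p ∣ q.

open import Data.Nat.Base
open import Data.Nat.Properties
open import Data.Nat.Solver using (module +-*-Solver)
open import Data.Nat.Divisibility using (_∣_; divides; ∣-refl; ∣1⇒≡1; ∣m+n∣m⇒∣n; ∣m⇒∣m*n; _∣?_)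
open import Data.Nat.Primality using (Prime; euclidsLemma; prime⇒nonTrivial)
open import Data.Integer.Base as ℤ using (ℤ; +_; -[1+_])
import Data.Integer.Properties as ℤ
open import Data.Integer.Divisibility.Signed as ℤ∣ using (∣ᵤ⇒∣; ∣⇒∣ᵤ) renaming (_∣_ to _∣ℤ_; _∣?_ to _∣ℤ?_)
open import Data.Integer.DivMod using (a≡a%ℕn+[a/ℕn]*n; n%ℕd<d)
open import Data.Integer.Solver using () renaming (module +-*-Solver to ℤ-Solver)
import Data.Rational as ℚ
open import Data.Rational using (ℚ; 1ℚ)
open import Data.Fin using (Fin; zero; suc)
open import Data.Vec using (Vec; []; _∷_; lookup; map; tabulate)
open import Data.Vec.Properties using (lookup-map; lookup∘tabulate)
open import Data.List using (List; []; _∷_; _++_; upTo)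
import Data.List as List
open import Data.List.Membership.Propositional using (_∈_)
open import Data.List.Membership.Propositional.Properties using (∈-++⁺ˡ; ∈-++⁺ʳ; ∈-map⁺; ∈-upTo⁺)
open import Data.List.Relation.Unary.Any using (here; there)
open import Data.Product using (Σ; ∃; _×_; _,_; proj₁; proj₂)
open import Data.Sum using (_⊎_; inj₁; inj₂; [_,_]′)
open import Data.Empty using (⊥-elim)
open import Relation.Nullary using (¬_; yes; no)
open import Relation.Nullary.Decidable using (decidable-stable)
open import Relation.Binary.PropositionalEquality
open import Defs

module NatArithmetic where
  open +-*-Solver using (solve; _:*_; _:+_; _:=_; con)
  open ≤-Reasoning

  ^-distribʳ-* : ∀ a b e → (a * b) ^ e ≡ a ^ e * b ^ e
  ^-distribʳ-* a b zero    = refl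
  ^-distribʳ-* a b (suc e) = begin-equality
    a * b * (a * b) ^ e     ≡⟨ cong (a * b *_) (^-distribʳ-* a b e) ⟩
    a * b * (a ^ e * b ^ e) ≡⟨ solve 4 (λ a b x y → a :* b :* (x :* y) := a :* x :* (b :* y)) refl a b (a ^ e) (b ^ e) ⟩
    a * a ^ e * (b * b ^ e) ∎

  n<m^n : ∀ m → 1 < m → ∀ n → n < m ^ n
  n<m^n m 1<m zero    = s≤s z≤n
  n<m^n m 1<m (suc n) = begin-strict
    suc n         ≤⟨ n<m^n m 1<m n ⟩
    m ^ n         <⟨ m<m+n (m ^ n) (<-≤-trans z<s (n<m^n m 1<m n)) ⟩
    m ^ n + m ^ n ≡⟨ solve 1 (λ y → y :+ y := con 2 :* y) refl (m ^ n) ⟩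
    2 * m ^ n     ≤⟨ *-monoˡ-≤ (m ^ n) 1<m ⟩
    m * m ^ n     ∎

  1≤m^n : ∀ m n → 1 ≤ m → 1 ≤ m ^ n
  1≤m^n m n 1≤m = m^n>0 m {{>-nonZero 1≤m}} n

  m≤m^[1+n] : ∀ m n → 1 ≤ m → m ≤ m ^ suc n
  m≤m^[1+n] m n 1≤m = m≤m*n m (m ^ n) {{>-nonZero (1≤m^n m n 1≤m)}}

  ^-cancelʳ-< : ∀ m → 1 < m → ∀ a b → m ^ a < m ^ b → a < b
  ^-cancelʳ-< m 1<m a b lt with a <? b
  ... | yes a<b = a<b
  ... | no a≮b  = ⊥-elim (<⇒≱ lt (^-monoʳ-≤ m {{>-nonZero (<-trans z<s 1<m)}} (≮⇒≥ a≮b)))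

  -- Bernoulli's inequality (1 + 1/m)^t ≥ 1 + t/m, cleared of denominators.
  bernoulli : ∀ m t → m ^ t * (m + t) ≤ m * suc m ^ t
  bernoulli m zero    = ≤-reflexive (solve 1 (λ m → con 1 :* (m :+ con 0) := m :* con 1) refl m)
  bernoulli m (suc t) = begin
    m * m ^ t * (m + suc t)       ≡⟨ solve 3 (λ m y t → m :* y :* (m :+ (con 1 :+ t)) := y :* (m :* (m :+ t :+ con 1))) refl m (m ^ t) t ⟩
    m ^ t * (m * (m + t + 1))     ≤⟨ *-monoʳ-≤ (m ^ t) (≤-trans (m≤m+n (m * (m + t + 1)) t) (≤-reflexive (solve 2 (λ m t → m :* (m :+ t :+ con 1) :+ t := (con 1 :+ m) :* (m :+ t)) refl m t))) ⟩
    m ^ t * ((1 + m) * (m + t))   ≡⟨ solve 3 (λ m y t → y :* ((con 1 :+ m) :* (m :+ t)) := (con 1 :+ m) :* (y :* (m :+ t))) refl m (m ^ t) t ⟩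
    suc m * (m ^ t * (m + t))     ≤⟨ *-monoʳ-≤ (suc m) (bernoulli m t) ⟩
    suc m * (m * suc m ^ t)       ≡⟨ solve 3 (λ m y w → y :* (m :* w) := m :* (y :* w)) refl m (suc m) (suc m ^ t) ⟩
    m * (suc m * suc m ^ t)       ∎

  doubling : ∀ m → 1 ≤ m → 2 * m ^ m ≤ suc m ^ m
  doubling m 1≤m = *-cancelˡ-≤ m {{>-nonZero 1≤m}} (begin
    m * (2 * m ^ m) ≡⟨ solve 2 (λ m y → m :* (con 2 :* y) := y :* (m :+ m)) refl m (m ^ m) ⟩
    m ^ m * (m + m) ≤⟨ bernoulli m m ⟩
    m * suc m ^ m   ∎)

  doubling^ : ∀ m u → 1 ≤ m → 2 ^ u * m ^ (m * u) ≤ suc m ^ (m * u)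
  doubling^ m zero    1≤m rewrite *-zeroʳ m = ≤-refl
  doubling^ m (suc u) 1≤m rewrite *-suc m u = begin
    2 ^ suc u * m ^ (m + m * u)         ≡⟨ cong (2 ^ suc u *_) (^-distribˡ-+-* m m (m * u)) ⟩
    2 * 2 ^ u * (m ^ m * m ^ (m * u))   ≡⟨ solve 3 (λ a b c → con 2 :* a :* (b :* c) := con 2 :* b :* (a :* c)) refl (2 ^ u) (m ^ m) (m ^ (m * u)) ⟩
    2 * m ^ m * (2 ^ u * m ^ (m * u))   ≤⟨ *-mono-≤ (doubling m 1≤m) (doubling^ m u 1≤m) ⟩
    suc m ^ m * suc m ^ (m * u)         ≡⟨ sym (^-distribˡ-+-* (suc m) m (m * u)) ⟩
    suc m ^ (m + m * u)                 ∎

  -- m^(b+d) < (m+1)^b as soon as m²d < b: an exponent (b+d)/b this close to 1 is beaten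
  -- by the ratio log(m+1)/log m.
  powerGap : ∀ m b d → 1 ≤ m → m * m * d < b → m ^ (b + d) < suc m ^ b
  powerGap m b d 1≤m m²d<b = begin-strict
    m ^ (b + d)                       ≡⟨ cong (λ z → m ^ (z + d)) (sym b≡) ⟩
    m ^ (m * u + e + d)               ≡⟨ cong (m ^_) (solve 3 (λ a e d → a :+ e :+ d := d :+ a :+ e) refl (m * u) e d) ⟩
    m ^ (d + m * u + e)               ≡⟨ trans (^-distribˡ-+-* m (d + m * u) e) (cong (_* m ^ e) (^-distribˡ-+-* m d (m * u))) ⟩
    m ^ d * m ^ (m * u) * m ^ e       ≤⟨ *-monoˡ-≤ (m ^ e) (*-monoˡ-≤ (m ^ (m * u)) m^d≤2^u) ⟩
    2 ^ u * m ^ (m * u) * m ^ e       <⟨ *-monoʳ-< (2 ^ u * m ^ (m * u)) {{>-nonZero (*-mono-≤ (1≤m^n 2 u z<s) (1≤m^n m (m * u) 1≤m))}} (^-monoˡ-< e {{>-nonZero e≥1}} (n<1+n m)) ⟩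
    2 ^ u * m ^ (m * u) * suc m ^ e   ≤⟨ *-monoˡ-≤ (suc m ^ e) (doubling^ m u 1≤m) ⟩
    suc m ^ (m * u) * suc m ^ e       ≡⟨ sym (^-distribˡ-+-* (suc m) (m * u) e) ⟩
    suc m ^ (m * u + e)               ≡⟨ cong (suc m ^_) b≡ ⟩
    suc m ^ b                         ∎
    where
    u = m * d
    e = b ∸ m * u
    mu<b : m * u < b
    mu<b = subst (_< b) (*-assoc m m d) m²d<b
    b≡ : m * u + e ≡ b
    b≡ = m+[n∸m]≡n (<⇒≤ mu<b)
    e≥1 : 1 ≤ e
    e≥1 = m<n⇒0<n∸m mu<b
    m^d≤2^u : m ^ d ≤ 2 ^ u
    m^d≤2^u = begin
      m ^ d       ≤⟨ ^-monoˡ-≤ d (<⇒≤ (n<m^n 2 (s≤s (s≤s z≤n)) m)) ⟩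
      (2 ^ m) ^ d ≡⟨ ^-*-assoc 2 m d ⟩
      2 ^ u       ∎

  ^-cancel-factor : ∀ c H N a b → .{{NonZero c}} → b ≤ a → (c * H) ^ a < (c * N) ^ b → H ^ a < N ^ b
  ^-cancel-factor c H N a b b≤a lt = *-cancelˡ-< (c ^ a) (H ^ a) (N ^ b) (begin-strict
    c ^ a * H ^ a ≡⟨ sym (^-distribʳ-* c H a) ⟩
    (c * H) ^ a   <⟨ lt ⟩
    (c * N) ^ b   ≡⟨ ^-distribʳ-* c N b ⟩
    c ^ b * N ^ b ≤⟨ *-monoˡ-≤ (N ^ b) (^-monoʳ-≤ c b≤a) ⟩
    c ^ a * N ^ b ∎)

  -- Taking p-adic valuations in (p^j·H)^a < (p^(j+k))^b with k ≤ V.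
  powerExponents : ∀ p → 1 < p → ∀ H j k V a b → 1 ≤ H → k ≤ V → (p ^ j * H) ^ a < (p ^ (j + k)) ^ b → j * a < (j + V) * b
  powerExponents p 1<p H j k V a b 1≤H k≤V lt = ^-cancelʳ-< p 1<p (j * a) ((j + V) * b) (begin-strict
    p ^ (j * a)       ≡⟨ sym (^-*-assoc p j a) ⟩
    (p ^ j) ^ a       ≤⟨ ^-monoˡ-≤ a (m≤m*n (p ^ j) H {{>-nonZero 1≤H}}) ⟩
    (p ^ j * H) ^ a   <⟨ lt ⟩
    (p ^ (j + k)) ^ b ≡⟨ ^-*-assoc p (j + k) b ⟩
    p ^ ((j + k) * b) ≤⟨ ^-monoʳ-≤ p {{>-nonZero (<-trans z<s 1<p)}} (*-monoˡ-≤ b (+-monoʳ-≤ j k≤V)) ⟩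
    p ^ ((j + V) * b) ∎)

  exponentBound : ∀ a b j V c → b ≤ a → j * a < (j + V) * b → V * c ≤ j → c * (a ∸ b) < b
  exponentBound a b j V c b≤a lt Vc≤j = *-cancelˡ-< V (c * d) b (begin-strict
    V * (c * d) ≡⟨ sym (*-assoc V c d) ⟩
    V * c * d   ≤⟨ *-monoˡ-≤ d Vc≤j ⟩
    j * d       <⟨ jd<Vb ⟩
    V * b       ∎)
    where
    d = a ∸ b
    jd<Vb : j * d < V * b
    jd<Vb = +-cancelˡ-< (j * b) (j * d) (V * b) (begin-strict
      j * b + j * d ≡⟨ sym (*-distribˡ-+ j b d) ⟩
      j * (b + d)   ≡⟨ cong (j *_) (m+[n∸m]≡n b≤a) ⟩
      j * a         <⟨ lt ⟩
      (j + V) * b   ≡⟨ *-distribʳ-+ b j V ⟩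
      j * b + V * b ∎)

open NatArithmetic

scaleV : ∀ {m} → ℕ → Vec ℤ m → Vec ℤ m
scaleV c = map (+ c ℤ.*_)

scale : ∀ {m} → ℕ → Vec ℤ m × ℕ → Vec ℤ m × ℕ
scale c (r , q) = scaleV c r , c * q

hgt : ∀ {m} → Vec ℤ m × ℕ → ℕ
hgt (r , q) = height r q

q≤hgt : ∀ {m} (r : Vec ℤ m) q → q ≤ hgt (r , q)
q≤hgt r q = m≤n⊔m (maxAbs r) q

maxAbs-scale : ∀ {m} c (r : Vec ℤ m) → maxAbs (scaleV c r) ≡ c * maxAbs r
maxAbs-scale c []      = sym (*-zeroʳ c)
maxAbs-scale c (z ∷ r) = trans (cong₂ _⊔_ (ℤ.abs-* (+ c) z) (maxAbs-scale c r)) (sym (*-distribˡ-⊔ c ℤ.∣ z ∣ (maxAbs r)))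

hgt-scale : ∀ {m} c (e : Vec ℤ m × ℕ) → hgt (scale c e) ≡ c * hgt e
hgt-scale c (r , q) = trans (cong (_⊔ c * q) (maxAbs-scale c r)) (sym (*-distribˡ-⊔ c (maxAbs r) q))

scale-∘ : ∀ {m} a b (e : Vec ℤ m × ℕ) → scale a (scale b e) ≡ scale (a * b) e
scale-∘ a b (r , q) = cong₂ _,_ (scaleV-∘ r) (sym (*-assoc a b q))
  where
  scaleV-∘ : ∀ {m} (r : Vec ℤ m) → scaleV a (scaleV b r) ≡ scaleV (a * b) r
  scaleV-∘ []      = refl
  scaleV-∘ (z ∷ r) = cong₂ _∷_ (trans (sym (ℤ.*-assoc (+ a) (+ b) z)) (cong (ℤ._* z) (sym (ℤ.pos-* a b)))) (scaleV-∘ r)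

scale-1 : ∀ {m} (e : Vec ℤ m × ℕ) → scale 1 e ≡ e
scale-1 (r , q) = cong₂ _,_ (scaleV-1 r) (*-identityˡ q)
  where
  scaleV-1 : ∀ {m} (r : Vec ℤ m) → scaleV 1 r ≡ r
  scaleV-1 []      = refl
  scaleV-1 (z ∷ r) = cong₂ _∷_ (ℤ.*-identityˡ z) (scaleV-1 r)

divideVec : ∀ {m} c (r : Vec ℤ m) → (∀ i → + c ∣ℤ lookup r i) → Σ (Vec ℤ m) λ r' → r ≡ scaleV c r'
divideVec c []      c∣r = [] , refl
divideVec c (z ∷ r) c∣r with divideVec c r (λ i → c∣r (suc i)) | c∣r zero
... | r' , r≡ | ℤ∣.divides w z≡ = (w ∷ r') , cong₂ _∷_ (trans z≡ (ℤ.*-comm w (+ c))) r≡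

maxAbs-≤ : ∀ {m} (r : Vec ℤ m) B → (∀ i → ℤ.∣ lookup r i ∣ ≤ B) → maxAbs r ≤ B
maxAbs-≤ []      B bound = z≤n
maxAbs-≤ (z ∷ r) B bound = ⊔-lub (bound zero) (maxAbs-≤ r B (λ i → bound (suc i)))

maxHeight : ∀ {m} → List (Vec ℤ m × ℕ) → ℕ
maxHeight []      = 0
maxHeight (e ∷ L) = hgt e ⊔ maxHeight L

maxHeight-≥ : ∀ {m} {e : Vec ℤ m × ℕ} L → e ∈ L → hgt e ≤ maxHeight L
maxHeight-≥ (e ∷ L) (here refl) = m≤m⊔n (hgt e) (maxHeight L)
maxHeight-≥ (e ∷ L) (there e∈L) = ≤-trans (maxHeight-≥ L e∈L) (m≤n⊔m (hgt e) (maxHeight L))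

scalings : ∀ {m} → ℕ → List (Vec ℤ m × ℕ) → ℕ → List (Vec ℤ m × ℕ)
scalings p []      J = []
scalings p (e ∷ L) J = List.map (λ j → scale (p ^ j) e) (upTo J) ++ scalings p L J

scalings-∈ : ∀ {m} p {e : Vec ℤ m × ℕ} L {j J} → e ∈ L → j < J → scale (p ^ j) e ∈ scalings p L J
scalings-∈ p (e ∷ L) (here refl) j<J = ∈-++⁺ˡ (∈-map⁺ (λ j → scale (p ^ j) e) (∈-upTo⁺ j<J))
scalings-∈ p (e ∷ L) (there e∈L) j<J = ∈-++⁺ʳ _ (scalings-∈ p L e∈L j<J)

num den : ℚ → ℕ
num s = ℤ.∣ ℚ.numerator s ∣
den s = ℚ.denominatorℕ s

den≤num : ∀ s → 1ℚ ℚ.≤ s → den s ≤ num s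
den≤num s (ℚ.*≤* 1·b≤a·1) = go (ℚ.numerator s) (subst₂ ℤ._≤_ (ℤ.*-identityˡ _) (ℤ.*-identityʳ _) 1·b≤a·1)
  where
  go : ∀ a → + den s ℤ.≤ a → den s ≤ ℤ.∣ a ∣
  go (+ a)    (ℤ.+≤+ b≤a) = b≤a
  go -[1+ a ] ()

¬PowLt-1 : ∀ τ H → 1 ≤ H → ¬ PowLt τ H 1
¬PowLt-1 τ H 1≤H (s , _ , lt) = <⇒≱ lt (≤-trans (≤-reflexive (^-zeroˡ (den s))) (1≤m^n H (num s) 1≤H))

module Approximation (p : ℕ) (p-prime : Prime p) {n : ℕ} (τ : RealGe1) (x : Vec (Zp p) n) where
  open ℤ-Solver using (solve; _:+_; _:*_; _:-_; _:=_)

  1<p : 1 < p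
  1<p = nonTrivial⇒n>1 p {{prime⇒nonTrivial p-prime}}

  instance
    p≢0 : NonZero p
    p≢0 = >-nonZero (<-trans z<s 1<p)

  p∣t⇒p∤1+t : ∀ {t} → p ∣ t → ¬ p ∣ suc t
  p∣t⇒p∤1+t {t} p∣t p∣1+t = <⇒≢ 1<p (sym (∣1⇒≡1 (∣m+n∣m⇒∣n (subst (p ∣_) (+-comm 1 t) p∣1+t) p∣t)))

  pk : ℕ → ℤ
  pk k = + (p ^ k)

  pk∣pk : ∀ k d → pk k ∣ℤ pk (d + k)
  pk∣pk k d = ℤ∣.divides (pk d) (trans (cong +_ (^-distribˡ-+-* p d k)) (ℤ.pos-* (p ^ d) (p ^ k)))

  xᵢ : Fin n → ℕ → ℤ
  xᵢ i k = res (lookup x i) k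

  err : Vec ℤ n → ℕ → Fin n → ℕ → ℤ
  err r q i k = + q ℤ.* xᵢ i k ℤ.- lookup r i

  Agrees : Vec ℤ n × ℕ → ℕ → Set
  Agrees (r , q) k = ∀ i → pk k ∣ℤ err r q i k

  ApproxAt : Vec ℤ n × ℕ → ℕ → Set
  ApproxAt (r , q) k = 1 ≤ q × Agrees (r , q) k × PowLt τ (height r q) (p ^ k)

  approxAt⇒approx : ∀ r q {k} → ApproxAt (r , q) k → Approx p τ x r q
  approxAt⇒approx r q {k} (_ , agrees , close) = k , (λ i → ∣⇒∣ᵤ (agrees i)) , close

  approx⇒approxAt : ∀ r q → 1 ≤ q → Approx p τ x r q → ∃ (ApproxAt (r , q))
  approx⇒approxAt r q q≥1 (k , agrees , close) = k , q≥1 , (λ i → ∣ᵤ⇒∣ (agrees i)) , close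

  CoprimeApprox : Vec ℤ n × ℕ → Set
  CoprimeApprox (r , q) = 1 ≤ q × ¬ p ∣ q × Approx p τ x r q

  Tall : ℕ → Set
  Tall M = Σ (Vec ℤ n × ℕ) λ e → CoprimeApprox e × M < hgt e

  covered⇒¬tall : ∀ L → (∀ e → CoprimeApprox e → e ∈ L) → ¬ Tall (maxHeight L)
  covered⇒¬tall L covers (e , approx , M<h) = <⇒≱ M<h (maxHeight-≥ L (covers e approx))

  residue-coherent : ∀ i k d → pk k ∣ℤ (xᵢ i (d + k) ℤ.- xᵢ i k)
  residue-coherent i k zero    = ℤ∣.divides (+ 0) (ℤ.+-inverseʳ (xᵢ i k))
  residue-coherent i k (suc d) = subst (pk k ∣ℤ_) telescope
    (ℤ∣.∣m∣n⇒∣m+n {m = xᵢ i (suc d + k) ℤ.- xᵢ i (d + k)} (ℤ∣.∣-trans (pk∣pk k d) (∣ᵤ⇒∣ (coherent (lookup x i) (d + k)))) (residue-coherent i k d))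
    where
    telescope : xᵢ i (suc d + k) ℤ.- xᵢ i (d + k) ℤ.+ (xᵢ i (d + k) ℤ.- xᵢ i k) ≡ xᵢ i (suc d + k) ℤ.- xᵢ i k
    telescope = solve 3 (λ a b c → a :- b :+ (b :- c) := a :- c) refl (xᵢ i (suc d + k)) (xᵢ i (d + k)) (xᵢ i k)

  lowerLevel : ∀ {r q} i k d → pk k ∣ℤ err r q i (d + k) → pk k ∣ℤ err r q i k
  lowerLevel {r} {q} i k d p^k∣err = subst (pk k ∣ℤ_) difference
    (ℤ∣.∣m∣n⇒∣m-n p^k∣err (ℤ∣.∣n⇒∣m*n (+ q) (residue-coherent i k d)))
    where
    difference : err r q i (d + k) ℤ.- + q ℤ.* (xᵢ i (d + k) ℤ.- xᵢ i k) ≡ err r q i k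
    difference = solve 4 (λ q a b c → q :* a :- c :- q :* (a :- b) := q :* b :- c) refl (+ q) (xᵢ i (d + k)) (xᵢ i k) (lookup r i)

  agrees-mono : ∀ e {k K} → k ≤ K → Agrees e K → Agrees e k
  agrees-mono (r , q) {k} {K} k≤K agrees i = lowerLevel {r} {q} i k d
    (subst (λ l → pk k ∣ℤ err r q i l) (sym K≡) (ℤ∣.∣-trans (subst (λ l → pk k ∣ℤ pk l) K≡ (pk∣pk k d)) (agrees i)))
    where
    d = K ∸ k
    K≡ : d + k ≡ K
    K≡ = m∸n+n≡m k≤K

  err-scale : ∀ c r q i k → err (scaleV c r) (c * q) i k ≡ + c ℤ.* err r q i k
  err-scale c r q i k = trans (cong₂ (λ a b → a ℤ.* xᵢ i k ℤ.- b) (ℤ.pos-* c q) (lookup-map i (+ c ℤ.*_) r))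
    (solve 4 (λ c q y z → c :* q :* y :- c :* z := c :* (q :* y :- z)) refl (+ c) (+ q) (xᵢ i k) (lookup r i))

  agrees-scale : ∀ c e {k} → Agrees e k → Agrees (scale c e) k
  agrees-scale c (r , q) {k} agrees i = subst (pk k ∣ℤ_) (sym (err-scale c r q i k)) (ℤ∣.∣n⇒∣m*n (+ c) (agrees i))

  -- If p ∣ q, an approximation (r, q) at level k+1 is p·(r', q') for an approximation
  -- (r', q') at level k: p divides r since r ≡ q·x (mod p), and dividing the inequality
  -- height^τ < p^(k+1) by p^τ leaves height'^τ < p^k.
  divideOut : ∀ {r q k} → p ∣ q → ApproxAt (r , q) (suc k) → Σ (Vec ℤ n × ℕ) λ e' → (r , q) ≡ scale p e' × ApproxAt e' k
  divideOut {r} {q} {k} (divides q' q≡) (q≥1 , agrees , s , u , close) =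
    (r' , q') , e≡ , q'≥1 , agrees' , s , u , close'
    where
    q'≥1 : 1 ≤ q'
    q'≥1 = positive q' q≡
      where
      positive : ∀ t → q ≡ t * p → 1 ≤ t
      positive zero    q≡0 = ⊥-elim (<⇒≱ q≥1 (≤-reflexive q≡0))
      positive (suc t) _   = s≤s z≤n
    p∣p^[1+k] : + p ∣ℤ pk (suc k)
    p∣p^[1+k] = ℤ∣.divides (pk k) (trans (ℤ.pos-* p (p ^ k)) (ℤ.*-comm (+ p) (pk k)))
    p∣q : + p ∣ℤ + q
    p∣q = ℤ∣.divides (+ q') (trans (cong +_ q≡) (ℤ.pos-* q' p))
    p∣r : ∀ i → + p ∣ℤ lookup r i
    p∣r i = subst (+ p ∣ℤ_) (solve 2 (λ a b → a :- (a :- b) := b) refl (+ q ℤ.* xᵢ i (suc k)) (lookup r i))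
      (ℤ∣.∣m∣n⇒∣m-n (ℤ∣.∣m⇒∣m*n (xᵢ i (suc k)) p∣q) (ℤ∣.∣-trans p∣p^[1+k] (agrees i)))
    r' = proj₁ (divideVec p r p∣r)
    e≡ : (r , q) ≡ scale p (r' , q')
    e≡ = cong₂ _,_ (proj₂ (divideVec p r p∣r)) (trans q≡ (*-comm q' p))
    agrees' : Agrees (r' , q') k
    agrees' i = lowerLevel {r'} {q'} i k 1 (ℤ∣.*-cancelˡ-∣ (+ p)
      (subst₂ _∣ℤ_ (ℤ.pos-* p (p ^ k)) (trans (cong (λ e → err (proj₁ e) (proj₂ e) i (suc k)) e≡) (err-scale p r' q' i (suc k))) (agrees i)))
    close' : height r' q' ^ num s < (p ^ k) ^ den s
    close' = ^-cancel-factor p (height r' q') (p ^ k) (num s) (den s) (den≤num s (geOne τ u))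
      (subst (λ h → h ^ num s < (p ^ suc k) ^ den s) (trans (cong hgt e≡) (hgt-scale p (r' , q'))) close)

  record PrimitivePart (e : Vec ℤ n × ℕ) (k : ℕ) : Set where
    field
      j k₀    : ℕ
      e₀      : Vec ℤ n × ℕ
      e≡      : e ≡ scale (p ^ j) e₀
      k≡      : k ≡ j + k₀
      p∤q₀    : ¬ p ∣ proj₂ e₀
      approx₀ : ApproxAt e₀ k₀

  primitivePart-scale : ∀ {e k} e' → e ≡ scale p e' → PrimitivePart e' k → PrimitivePart e (suc k)
  primitivePart-scale e' e≡ P = record
    { j = suc j ; k₀ = k₀ ; e₀ = e₀
    ; e≡ = trans e≡ (trans (cong (scale p) (PrimitivePart.e≡ P)) (scale-∘ p (p ^ j) e₀))
    ; k≡ = cong suc k≡ ; p∤q₀ = p∤q₀ ; approx₀ = approx₀ }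
    where open PrimitivePart P hiding (e≡)

  -- Divide out p from q until p ∤ q; this stops before level 0, where nothing approximates.
  primitivePart : ∀ e k → ApproxAt e k → PrimitivePart e k
  primitivePart (r , q) zero (q≥1 , _ , close) = ⊥-elim (¬PowLt-1 τ (height r q) (≤-trans q≥1 (q≤hgt r q)) close)
  primitivePart (r , q) (suc k) approx with p ∣? q
  ... | no p∤q = record
    { j = 0 ; k₀ = suc k ; e₀ = r , q ; e≡ = sym (scale-1 (r , q)) ; k≡ = refl ; p∤q₀ = p∤q ; approx₀ = approx }
  ... | yes p∣q = fromQuotient (divideOut {r} {q} {k} p∣q approx)
    where
    fromQuotient : Σ (Vec ℤ n × ℕ) (λ e' → (r , q) ≡ scale p e' × ApproxAt e' k) → PrimitivePart (r , q) (suc k)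
    fromQuotient (e' , e≡ , approx') = primitivePart-scale e' e≡ (primitivePart e' k approx')

  Exact : Vec ℤ n × ℕ → Set
  Exact e = ∀ K → Agrees e K

  -- If q₀·x = r₀ exactly with p ∤ q₀, then m·(r₀, q₀) with m = 1 + p(M+1) is a coprime
  -- approximation of height above M: it agrees at any level, in particular at one
  -- exceeding height^a.
  exact⇒tall : ∀ e → Exact e → 1 ≤ proj₂ e → ¬ p ∣ proj₂ e → ∀ M → Tall M
  exact⇒tall (r₀ , q₀) exact q₀≥1 p∤q₀ M =
    scale m (r₀ , q₀) , (mq₀≥1 , p∤mq₀ , approxAt⇒approx (scaleV m r₀) (m * q₀) (mq₀≥1 , agrees-scale m (r₀ , q₀) (exact K) , s , u , close)) , M<H
    where
    m = suc (p * suc M)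
    H = hgt (scale m (r₀ , q₀))
    s = proj₁ (inhabited τ)
    u = proj₂ (inhabited τ)
    K = H ^ num s
    mq₀≥1 : 1 ≤ m * q₀
    mq₀≥1 = *-mono-≤ {1} {m} z<s q₀≥1
    p∤mq₀ : ¬ p ∣ m * q₀
    p∤mq₀ p∣mq₀ with euclidsLemma m q₀ p-prime p∣mq₀
    ... | inj₁ p∣m  = p∣t⇒p∤1+t (∣m⇒∣m*n (suc M) ∣-refl) p∣m
    ... | inj₂ p∣q₀ = p∤q₀ p∣q₀
    close : H ^ num s < (p ^ K) ^ den s
    close = <-≤-trans (n<m^n p 1<p K) (m≤m^[1+n] (p ^ K) (ℚ.denominator-1 s) (1≤m^n p K (<⇒≤ 1<p)))
    M<H : M < H
    M<H = begin-strict
      M                   <⟨ n<1+n M ⟩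
      suc M               ≤⟨ m≤n*m (suc M) p ⟩
      p * suc M           <⟨ n<1+n (p * suc M) ⟩
      m                   ≤⟨ m≤m*n m (hgt (r₀ , q₀)) {{>-nonZero (≤-trans q₀≥1 (q≤hgt r₀ q₀))}} ⟩
      m * hgt (r₀ , q₀)   ≡⟨ sym (hgt-scale m (r₀ , q₀)) ⟩
      H                   ∎
      where open ≤-Reasoning

  reducedMultiple : ∀ c K → Σ (Vec ℤ n) λ r → Agrees (r , c) K × (∀ i → ℤ.∣ lookup r i ∣ < p ^ K)
  reducedMultiple c K = r , agrees , bound
    where
    N = p ^ K
    instance
      N≢0 : NonZero N
      N≢0 = m^n≢0 p K
    A : Fin n → ℤ
    A i = + c ℤ.* xᵢ i K
    r = tabulate (λ i → + (A i ℤ.%ℕ N))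
    agrees : Agrees (r , c) K
    agrees i = ℤ∣.divides (A i ℤ./ℕ N) (begin
      A i ℤ.- lookup r i                                    ≡⟨ cong (λ z → A i ℤ.- z) (lookup∘tabulate _ i) ⟩
      A i ℤ.- + (A i ℤ.%ℕ N)                                ≡⟨ cong (ℤ._- + (A i ℤ.%ℕ N)) (a≡a%ℕn+[a/ℕn]*n (A i) N) ⟩
      + (A i ℤ.%ℕ N) ℤ.+ A i ℤ./ℕ N ℤ.* + N ℤ.- + (A i ℤ.%ℕ N) ≡⟨ solve 2 (λ a b → a :+ b :- a := b) refl (+ (A i ℤ.%ℕ N)) (A i ℤ./ℕ N ℤ.* + N) ⟩
      A i ℤ./ℕ N ℤ.* + N                                    ∎)
      where open ≡-Reasoning
    bound : ∀ i → ℤ.∣ lookup r i ∣ < N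
    bound i = subst (λ z → ℤ.∣ z ∣ < N) (sym (lookup∘tabulate _ i)) (n%ℕd<d (A i) N)

  modulus : ℕ → ℕ
  modulus M = p ^ suc M ∸ 1

  -- If some s = a/b > τ has m²(a − b) < b, m = modulus M, then (m·x mod p^(M+1), m) is a
  -- coprime approximation of height m > M, since m^a < (m+1)^b = (p^(M+1))^b.
  nearOne⇒tall : ∀ M s → Upper τ s → modulus M * modulus M * (num s ∸ den s) < den s → Tall M
  nearOne⇒tall M s u m²d<b = (r , m) , (m≥1 , p∤m , approxAt⇒approx r m (m≥1 , agrees , s , u , close)) , subst (M <_) (sym height≡m) M<m
    where
    K = suc M
    N = p ^ K
    m = modulus M
    1+m≡N : suc m ≡ N
    1+m≡N = trans (+-comm 1 m) (m∸n+n≡m (1≤m^n p K (<⇒≤ 1<p)))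
    M<m : M < m
    M<m = s≤s⁻¹ (subst (suc M <_) (sym 1+m≡N) (n<m^n p 1<p K))
    m≥1 : 1 ≤ m
    m≥1 = ≤-trans (s≤s z≤n) M<m
    p∤m : ¬ p ∣ m
    p∤m p∣m = p∣t⇒p∤1+t p∣m (subst (p ∣_) (sym 1+m≡N) (∣m⇒∣m*n (p ^ M) ∣-refl))
    reduced = reducedMultiple m K
    r = proj₁ reduced
    agrees = proj₁ (proj₂ reduced)
    height≡m : height r m ≡ m
    height≡m = m≤n⇒m⊔n≡n (maxAbs-≤ r m λ i → s≤s⁻¹ (subst (ℤ.∣ lookup r i ∣ <_) (sym 1+m≡N) (proj₂ (proj₂ reduced) i)))
    close : height r m ^ num s < N ^ den s
    close = subst₂ (λ h z → h ^ num s < z ^ den s) (sym height≡m) 1+m≡N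
      (subst (λ a → m ^ a < suc m ^ den s) (m+[n∸m]≡n (den≤num s (geOne τ u))) (powerGap m (den s) (num s ∸ den s) m≥1 m²d<b))

  FailsBy : Vec ℤ n × ℕ → ℕ → Set
  FailsBy (r , q) V = Σ ℕ λ K → K ≤ V × Σ (Fin n) λ i → ¬ pk K ∣ℤ err r q i K

  Settled : Vec ℤ n × ℕ → ℕ → Set
  Settled e V = Exact e ⊎ FailsBy e V

  settled-mono : ∀ e {V W} → V ≤ W → Settled e V → Settled e W
  settled-mono e       V≤W (inj₁ exact)             = inj₁ exact
  settled-mono (r , q) V≤W (inj₂ (K , K≤V , fails)) = inj₂ (K , ≤-trans K≤V V≤W , fails)

  -- Classically every e is settled at some level: one that never fails is exact, as
  -- divisibility is decidable.
  settledSomewhere : ∀ e → ¬ ¬ Σ ℕ (Settled e)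
  settledSomewhere (r , q) unsettled = unsettled (0 , inj₁ λ K i →
    decidable-stable (pk K ∣ℤ? err r q i K) λ fails → unsettled (K , inj₂ (K , ≤-refl , i , fails)))

  settledBound : ∀ L → ¬ ¬ Σ ℕ λ V → ∀ e → e ∈ L → Settled e V
  settledBound []      unbounded = unbounded (0 , λ _ ())
  settledBound (e ∷ L) unbounded = settledBound L λ { (V , settledL) → settledSomewhere e λ { (W , settledₑ) →
    unbounded (V ⊔ W , λ { e' (here refl)    → settled-mono e' (m≤n⊔m V W) settledₑ
                         ; e' (there e'∈L) → settled-mono e' (m≤m⊔n V W) (settledL e' e'∈L) }) } }

  agrees-below-failure : ∀ e {k V} → Agrees e k → FailsBy e V → k < V
  agrees-below-failure e {k} agrees (K , K≤V , i , fails) with k <? K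
  ... | yes k<K = <-≤-trans k<K K≤V
  ... | no  k≮K = ⊥-elim (fails (agrees-mono e (≮⇒≥ k≮K) agrees i))

  -- A scaling exponent j ≥ V·c forces c·(a − b) < b for s = a/b > τ, when the primitive
  -- part fails by level V: (p^j·H₀)^a < (p^(j+k₀))^b with k₀ < V compares p-powers.
  largeScaling : ∀ {e k} (P : PrimitivePart e k) V c s → Upper τ s → hgt e ^ num s < (p ^ k) ^ den s
               → FailsBy (PrimitivePart.e₀ P) V → V * c ≤ PrimitivePart.j P → c * (num s ∸ den s) < den s
  largeScaling {e} {k} P V c s u close fails Vc≤j = exponentBound (num s) (den s) j V c (den≤num s (geOne τ u))
    (powerExponents p 1<p (hgt e₀) j k₀ V (num s) (den s) H₀≥1 (<⇒≤ (agrees-below-failure e₀ (proj₁ (proj₂ approx₀)) fails)) close₀)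
    Vc≤j
    where
    open PrimitivePart P
    H₀≥1 : 1 ≤ hgt e₀
    H₀≥1 = ≤-trans (proj₁ approx₀) (q≤hgt (proj₁ e₀) (proj₂ e₀))
    close₀ : (p ^ j * hgt e₀) ^ num s < (p ^ (j + k₀)) ^ den s
    close₀ = subst₂ (λ h l → h ^ num s < (p ^ l) ^ den s) (trans (cong hgt e≡) (hgt-scale (p ^ j) e₀)) k≡ close

  boundedScaling : ∀ M V {e k} → ApproxAt e k → (P : PrimitivePart e k) → Settled (PrimitivePart.e₀ P) V
                 → PrimitivePart.j P < V * (modulus M * modulus M) ⊎ Tall M
  boundedScaling M V _ P (inj₁ exact) =
    inj₂ (exact⇒tall (PrimitivePart.e₀ P) exact (proj₁ (PrimitivePart.approx₀ P)) (PrimitivePart.p∤q₀ P) M)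
  boundedScaling M V (_ , _ , s , u , close) P (inj₂ fails) with PrimitivePart.j P <? V * (modulus M * modulus M)
  ... | yes j<J = inj₁ j<J
  ... | no  j≮J = inj₂ (nearOne⇒tall M s u (largeScaling P V (modulus M * modulus M) s u close fails (≮⇒≥ j≮J)))

  approximations∈scalings : ∀ L → (∀ e → CoprimeApprox e → e ∈ L) → ∀ V → (∀ e → e ∈ L → Settled e V)
    → ∀ r q → 1 ≤ q → Approx p τ x r q → (r , q) ∈ scalings p L (V * (modulus (maxHeight L) * modulus (maxHeight L)))
  approximations∈scalings L covers V settled r q q≥1 approx =
    [ (λ j<J → subst (_∈ scalings p L _) (sym e≡) (scalings-∈ p L e₀∈L j<J))
    , (λ tall → ⊥-elim (covered⇒¬tall L covers tall)) ]′
    (boundedScaling (maxHeight L) V approxₖ P (settled e₀ e₀∈L))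
    where
    k = proj₁ (approx⇒approxAt r q q≥1 approx)
    approxₖ = proj₂ (approx⇒approxAt r q q≥1 approx)
    P = primitivePart (r , q) k approxₖ
    open PrimitivePart P
    e₀∈L : e₀ ∈ L
    e₀∈L = covers e₀ (proj₁ approx₀ , p∤q₀ , approxAt⇒approx (proj₁ e₀) (proj₂ e₀) approx₀)

corollary1 : (p : ℕ) → Prime p → (n : ℕ) → 1 ≤ n → (τ : RealGe1)
    → (x : Vec (Zp p) n) → ¬ InWStar p n τ x
corollary1 p p-prime n _ τ x (infinitelyMany , L , covers) = settledBound L λ { (V , settled) →
  infinitelyMany (scalings p L (V * (modulus (maxHeight L) * modulus (maxHeight L))) ,
    λ { (r , q) (q≥1 , _ , approx) → approximations∈scalings L covers V settled r q q≥1 approx }) }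
  where open Approximation p p-prime τ x
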